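{- Let $t\ge t'>0$ be integers and let $G$ be a graph. Let $\mathcal{F}$ be a $<_{\mathrm{lex}}$-minimal spanning linear forest in $G$, with path lengths $\ell_1\ge\dots\ge\ell_t$. Let $\mathcal{F}'$ be another spanning linear forest in $G$ with path lengths $s_1\ge\dots\ge s_t$, such that $\ell_i=s_i$ for each $i<t'$. Let $x$ be an endpoint in $\mathcal{F}'$ of a path of length at most $s_{t'}$. Then $N_G(x)\subseteq S_{\mathcal{F}'}(0,5s_{t'})$.
   Context: A linear forest is a vertex-disjoint union of paths (single vertices allowed). The length of a path is its number of vertices. For linear forests $\mathcal{F}_1,\mathcal{F}_2$, $\mathcal{F}_1<_{\mathrm{lex}}\mathcal{F}_2$ if $\mathcal{F}_1$ has fewer paths, or they have the same number of paths and the vector of path lengths of $\mathcal{F}_1$ in decreasing order is lexicographically smaller than that of $\mathcal{F}_2$; $<_{\mathrm{lex}}$-minimal means minimal among all spanning linear forests of $G$. For a linear forest $\mathcal{F}$ and integers $a,b$, $S_{\mathcal{F}}(a,b)$ is the set of vertices lying on paths of $\mathcal{F}$ of length at least $a$ and at most $b$. $N_G(x)$ is the set of neighbours of $x$ in $G$. -}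

module Defs where

open import Data.Nat using (ℕ; zero; suc; _≤_; _<_; _≤?_)
open import Data.Fin using (Fin)
open import Data.List using (List; []; _∷_; _∷ʳ_; length; map; concat)
open import Data.List.Membership.Propositional using (_∈_)
open import Data.List.Relation.Unary.All using (All)
open import Data.List.Relation.Unary.Linked using (Linked)
open import Data.List.Relation.Unary.Unique.Propositional using (Unique)
open import Data.Product using (Σ; ∃; _×_; _,_)
open import Data.Sum using (_⊎_)
open import Data.Empty using (⊥)
open import Relation.Nullary using (¬_; yes; no)
open import Relation.Binary.PropositionalEquality using (_≡_; _≢_)

record Graph (n : ℕ) : Set₁ where
  field
    Adj     : Fin n → Fin n → Set
    sym     : ∀ {x y} → Adj x y → Adj y x
    irrefl  : ∀ {x} → ¬ Adj x x
open Graph public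

-- A path is a nonempty list of vertices, consecutive ones adjacent.
-- Its length is its number of vertices (the list length).
IsPath : ∀ {n} → Graph n → List (Fin n) → Set
IsPath G P = (P ≢ []) × Linked (Adj G) P

SpanningLinearForest : ∀ {n} → Graph n → List (List (Fin n)) → Set
SpanningLinearForest G F =
  All (IsPath G) F × Unique (concat F) × (∀ v → v ∈ concat F)

insertDesc : ℕ → List ℕ → List ℕ
insertDesc x [] = x ∷ []
insertDesc x (y ∷ ys) with y ≤? x
... | yes _ = x ∷ y ∷ ys
... | no  _ = y ∷ insertDesc x ys

sortDesc : List ℕ → List ℕ
sortDesc [] = []
sortDesc (x ∷ xs) = insertDesc x (sortDesc xs)

lengths : ∀ {n} → List (List (Fin n)) → List ℕ
lengths F = sortDesc (map length F)

data LexLt : List ℕ → List ℕ → Set where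
  lt-nil  : ∀ {y ys} → LexLt [] (y ∷ ys)
  lt-head : ∀ {x y xs ys} → x < y → LexLt (x ∷ xs) (y ∷ ys)
  lt-tail : ∀ {x xs ys} → LexLt xs ys → LexLt (x ∷ xs) (x ∷ ys)

_<lex_ : ∀ {n} → List (List (Fin n)) → List (List (Fin n)) → Set
F₁ <lex F₂ = (length F₁ < length F₂)
           ⊎ ((length F₁ ≡ length F₂) × LexLt (lengths F₁) (lengths F₂))

LexMinimal : ∀ {n} → Graph n → List (List (Fin n)) → Set
LexMinimal G F = SpanningLinearForest G F ×
  (∀ F'' → SpanningLinearForest G F'' → ¬ (F'' <lex F))

-- 0-indexed lookup with default 0.
nth : List ℕ → ℕ → ℕ
nth [] _ = 0
nth (x ∷ xs) zero = x
nth (x ∷ xs) (suc i) = nth xs i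

IsEndpoint : ∀ {n} → Fin n → List (Fin n) → Set
IsEndpoint x P = (∃ λ ps → P ≡ x ∷ ps) ⊎ (∃ λ ps → P ≡ ps ∷ʳ x)

S : ∀ {n} → List (List (Fin n)) → ℕ → ℕ → Fin n → Set
S F a b v = ∃ λ P → P ∈ F × v ∈ P × a ≤ length P × length P ≤ b

{-# OPTIONS --safe #-}
-- Let y ∼ x lie on the path Q of F′ and suppose |Q| exceeds both s_{t′} and 2|P| + 1.
-- Cutting Q at y leaves a longer side D with |Q| ≤ 2|D| + 1, and the shorter side, y and
-- the edge yx glue onto P at its endpoint x to form a path N. Replacing P, Q by N, D gives
-- a spanning linear forest with as many paths, where N and D are shorter than Q and all
-- paths longer than Q are untouched. As |Q| > s_{t′}, the sorted length vector first drops
-- at a position before t′, where F and F′ agree, so the new forest is <lex-below F.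
-- The bound 5 s_{t′} follows since 2|P| + 1 ≤ 2 s_{t′} + 1 ≤ 5 s_{t′}.
module Submission where

open import Defs hiding (sym)
open import Data.Nat using (ℕ; zero; suc; _≤_; _<_; _≥_; _≤?_; _*_; _+_; _∸_; z≤n; s≤s; z<s; s<s; s<s⁻¹)
open import Data.Nat.Properties
open import Data.Fin using (Fin)
open import Data.List using (List; []; _∷_; [_]; _++_; _ʳ++_; length; filter; concat; reverse)
open import Data.List.Properties using (filter-accept; filter-reject; length-++; length-reverse; reverse-++; unfold-reverse; ++-assoc)
open import Data.List.Membership.Propositional using (_∈_)
open import Data.List.Membership.Propositional.Properties using (∈-∃++; ∈-concat⁻′)
open import Data.List.Relation.Unary.All as All using (All; []; _∷_)
open import Data.List.Relation.Unary.Any using (here; there)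
open import Data.List.Relation.Unary.AllPairs using (AllPairs; []; _∷_)
open import Data.List.Relation.Unary.Linked using (Linked; []; [-]; _∷_; tail)
open import Data.List.Relation.Binary.Permutation.Propositional as ↭
  using (_↭_; prep; swap; ↭-refl; ↭-sym; ↭-trans; ↭-reflexive; ↭⇒↭ₛ; module PermutationReasoning)
open import Data.List.Relation.Binary.Permutation.Propositional.Properties
  using (All-resp-↭; ∈-resp-↭; ↭-length; ++⁺ˡ; ++⁺ʳ; ++-comm; shift; shifts; ++↭ʳ++; ↭-reverse; filter-↭)
  renaming (map⁺ to ↭-map⁺)
import Data.List.Relation.Binary.Permutation.Setoid.Properties as SetoidPermutation
open import Data.Product using (∃; ∃₂; _×_; _,_; proj₁; proj₂)
open import Data.Sum using (inj₁; inj₂)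
open import Function using (_∘_)
open import Level using (Level)
open import Relation.Binary.Core using (Rel)
open import Relation.Binary.Definitions using (Symmetric)
open import Relation.Nullary using (¬_; yes; no; contradiction)
open import Relation.Binary.PropositionalEquality
  using (_≡_; _≢_; refl; sym; trans; cong; subst; subst₂; setoid; module ≡-Reasoning)

private
  variable
    a ℓ : Level
    A : Set a

<-from-sum : ∀ {a b c d} → a + b ≡ c + d → c < b → a < d
<-from-sum {a} {b} {c} {d} a+b≡c+d c<b = +-cancelʳ-< b a d (begin-strict
  a + b   ≡⟨ a+b≡c+d ⟩
  c + d   <⟨ +-monoˡ-< d c<b ⟩
  b + d   ≡⟨ +-comm b d ⟩
  d + b   ∎)
  where open ≤-Reasoning

n+suc[n]≤5*n : ∀ {n} → 0 < n → n + suc n ≤ 5 * n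
n+suc[n]≤5*n {n} 0<n = +-monoʳ-≤ n (begin
  suc n                   ≡⟨ +-comm 1 n ⟩
  n + 1                   ≤⟨ +-monoʳ-≤ n (≤-trans 0<n (m≤m+n n _)) ⟩
  n + (n + (n + (n + 0))) ∎)
  where open ≤-Reasoning

count≥ : ℕ → List ℕ → ℕ
count≥ v xs = length (filter (v ≤?_) xs)

count≥-accept : ∀ {v x} xs → v ≤ x → count≥ v (x ∷ xs) ≡ suc (count≥ v xs)
count≥-accept xs v≤x = cong length (filter-accept (_ ≤?_) v≤x)

count≥-reject : ∀ {v x} xs → x < v → count≥ v (x ∷ xs) ≡ count≥ v xs
count≥-reject xs x<v = cong length (filter-reject (_ ≤?_) (<⇒≱ x<v))

count≥-↭ : ∀ v {xs ys} → xs ↭ ys → count≥ v xs ≡ count≥ v ys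
count≥-↭ v = ↭-length ∘ filter-↭ (v ≤?_)

insertDesc-↭ : ∀ x xs → insertDesc x xs ↭ x ∷ xs
insertDesc-↭ x [] = ↭-refl
insertDesc-↭ x (y ∷ ys) with y ≤? x
... | yes _ = ↭-refl
... | no  _ = ↭-trans (prep y (insertDesc-↭ x ys)) (swap y x ↭-refl)

sortDesc-↭ : ∀ xs → sortDesc xs ↭ xs
sortDesc-↭ []       = ↭-refl
sortDesc-↭ (x ∷ xs) = ↭-trans (insertDesc-↭ x (sortDesc xs)) (prep x (sortDesc-↭ xs))

Descending : List ℕ → Set
Descending = AllPairs _≥_

insertDesc-descending : ∀ x {xs} → Descending xs → Descending (insertDesc x xs)
insertDesc-descending x {[]}     [] = [] ∷ []
insertDesc-descending x {y ∷ ys} (y≥ys ∷ ys↓) with y ≤? x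
... | yes y≤x = (y≤x ∷ All.map (λ z≤y → ≤-trans z≤y y≤x) y≥ys) ∷ y≥ys ∷ ys↓
... | no  y≰x = All-resp-↭ (↭-sym (insertDesc-↭ x ys)) (≰⇒≥ y≰x ∷ y≥ys)
              ∷ insertDesc-descending x ys↓

sortDesc-descending : ∀ xs → Descending (sortDesc xs)
sortDesc-descending []       = []
sortDesc-descending (x ∷ xs) = insertDesc-descending x (sortDesc-descending xs)

nth-≤-head : ∀ {x xs} i → Descending (x ∷ xs) → nth (x ∷ xs) i ≤ x
nth-≤-head zero    _          = ≤-refl
nth-≤-head (suc i) (x≥xs ∷ _) = bounded i x≥xs
  where
  bounded : ∀ {x xs} i → All (_≤ x) xs → nth xs i ≤ x
  bounded i       []         = z≤n
  bounded zero    (y≤x ∷ _)  = y≤x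
  bounded (suc i) (_ ∷ x≥ys) = bounded i x≥ys

-- In a descending list the entries ≥ v are exactly the first count≥ v ones; the
-- converse direction needs v > 0 because nth pads with zeros.
<count≥⇒≤nth : ∀ {v xs} i → Descending xs → i < count≥ v xs → v ≤ nth xs i
<count≥⇒≤nth {v} {x ∷ xs} i xs↓@(_ ∷ tail↓) i<c with v ≤? x | i
... | yes v≤x | zero  = v≤x
... | yes v≤x | suc j = <count≥⇒≤nth j tail↓ (s<s⁻¹ (subst (suc j <_) (count≥-accept xs v≤x) i<c))
... | no  v≰x | j     =
  contradiction (≤-trans (<count≥⇒≤nth j tail↓ j<c) (nth-≤-head (suc j) xs↓)) v≰x
  where
  j<c : j < count≥ v xs
  j<c = subst (j <_) (count≥-reject xs (≰⇒> v≰x)) i<c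

≤nth⇒<count≥ : ∀ {v xs} i → Descending xs → 0 < v → v ≤ nth xs i → i < count≥ v xs
≤nth⇒<count≥ {v} {[]}     i []  0<v v≤0 = contradiction v≤0 (<⇒≱ 0<v)
≤nth⇒<count≥ {v} {x ∷ xs} i xs↓@(_ ∷ tail↓) 0<v v≤xᵢ with v ≤? x | i
... | yes v≤x | zero  = subst (0 <_) (sym (count≥-accept xs v≤x)) z<s
... | yes v≤x | suc j = subst (suc j <_) (sym (count≥-accept xs v≤x)) (s<s (≤nth⇒<count≥ j tail↓ 0<v v≤xᵢ))
... | no  v≰x | j     = contradiction (≤-trans v≤xᵢ (nth-≤-head j xs↓)) v≰x

nth-≤-nth : ∀ {q X Y} i → Descending X → Descending Y →
  (∀ v → q < v → count≥ v X ≡ count≥ v Y) → i < count≥ q Y → nth X i ≤ nth Y i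
nth-≤-nth {q} {X} {Y} i X↓ Y↓ same-above i<cY = ≮⇒≥ Yᵢ≮Xᵢ
  where
  -- Otherwise the threshold 1 + nth Y i, which lies above q, sees i in X but not in Y.
  Yᵢ≮Xᵢ : ¬ nth Y i < nth X i
  Yᵢ≮Xᵢ Yᵢ<Xᵢ = n≮n (nth Y i) (<count≥⇒≤nth i Y↓ i<cY′)
    where
    q<v : q < suc (nth Y i)
    q<v = s≤s (<count≥⇒≤nth i Y↓ i<cY)
    i<cY′ : i < count≥ (suc (nth Y i)) Y
    i<cY′ = subst (i <_) (same-above _ q<v) (≤nth⇒<count≥ i X↓ z<s Yᵢ<Xᵢ)

count≥-first-difference : ∀ {q X Y} → Descending X → Descending Y → 0 < q →
  (∀ v → q < v → count≥ v X ≡ count≥ v Y) → count≥ q Y ≡ suc (count≥ q X) →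
  (∀ i → i < count≥ q X → nth X i ≡ nth Y i) × nth X (count≥ q X) < nth Y (count≥ q X)
count≥-first-difference {q} {X} {Y} X↓ Y↓ 0<q same-above cY≡1+cX = agree , differ
  where
  k : ℕ
  k = count≥ q X
  k<cY : k < count≥ q Y
  k<cY = ≤-reflexive (sym cY≡1+cX)
  agree : ∀ i → i < k → nth X i ≡ nth Y i
  agree i i<k = ≤-antisym (nth-≤-nth i X↓ Y↓ same-above (<-trans i<k k<cY))
                          (nth-≤-nth i Y↓ X↓ (λ v → sym ∘ same-above v) i<k)
  differ : nth X k < nth Y k
  differ = <-≤-trans (≰⇒> (λ q≤Xₖ → n≮n k (≤nth⇒<count≥ k X↓ 0<q q≤Xₖ)))
                     (<count≥⇒≤nth k Y↓ k<cY)

LexLt-at : ∀ k {X Y} → (∀ i → i < k → nth X i ≡ nth Y i) → nth X k < nth Y k → LexLt X Y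
LexLt-at zero    {[]}    {_ ∷ _} _     _   = lt-nil
LexLt-at zero    {_ ∷ _} {_ ∷ _} _     x<y = lt-head x<y
LexLt-at (suc k) {[]}    {_ ∷ _} _     _   = lt-nil
LexLt-at (suc k) {_ ∷ _} {_ ∷ _} agree x<y with refl ← agree 0 z<s =
  lt-tail (LexLt-at k (λ i → agree (suc i) ∘ s<s) x<y)

-- The sorted vector first drops at position count≥ q, which is below t₀ because the
-- t₀-th entry is below q; so zs need only agree with it before t₀.
LexLt-exchange : ∀ {xs p q a b rs} zs t₀ → xs ↭ p ∷ q ∷ rs → p < q → a < q → b < q →
  nth (sortDesc xs) t₀ < q → (∀ j → j < t₀ → nth zs j ≡ nth (sortDesc xs) j) →
  LexLt (sortDesc (a ∷ b ∷ rs)) zs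
LexLt-exchange {xs} {p} {q} {a} {b} {rs} zs t₀ σ p<q a<q b<q Yₜ₀<q zs≡Y =
  LexLt-at k (λ i i<k → trans (agree i i<k) (sym (zs≡Y i (<-trans i<k k<t₀))))
             (subst (nth X k <_) (sym (zs≡Y k k<t₀)) differ)
  where
  X Y : List ℕ
  X = sortDesc (a ∷ b ∷ rs)
  Y = sortDesc xs
  k : ℕ
  k = count≥ q X
  cX : ∀ v → q ≤ v → count≥ v X ≡ count≥ v rs
  cX v q≤v = begin
    count≥ v X                ≡⟨ count≥-↭ v (sortDesc-↭ (a ∷ b ∷ rs)) ⟩
    count≥ v (a ∷ b ∷ rs)     ≡⟨ count≥-reject (b ∷ rs) (<-≤-trans a<q q≤v) ⟩
    count≥ v (b ∷ rs)         ≡⟨ count≥-reject rs (<-≤-trans b<q q≤v) ⟩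
    count≥ v rs               ∎
    where open ≡-Reasoning
  cY : ∀ v → q ≤ v → count≥ v Y ≡ count≥ v (q ∷ rs)
  cY v q≤v = trans (count≥-↭ v (↭-trans (sortDesc-↭ xs) σ))
                   (count≥-reject (q ∷ rs) (<-≤-trans p<q q≤v))
  same-above : ∀ v → q < v → count≥ v X ≡ count≥ v Y
  same-above v q<v =
    trans (cX v (<⇒≤ q<v)) (sym (trans (cY v (<⇒≤ q<v)) (count≥-reject rs q<v)))
  cY≡1+cX : count≥ q Y ≡ suc k
  cY≡1+cX =
    trans (cY q ≤-refl) (trans (count≥-accept rs ≤-refl) (cong suc (sym (cX q ≤-refl))))
  agree : ∀ i → i < k → nth X i ≡ nth Y i
  agree = proj₁ (count≥-first-difference (sortDesc-descending (a ∷ b ∷ rs))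
                   (sortDesc-descending xs) (≤-<-trans z≤n p<q) same-above cY≡1+cX)
  differ : nth X k < nth Y k
  differ = proj₂ (count≥-first-difference (sortDesc-descending (a ∷ b ∷ rs))
                    (sortDesc-descending xs) (≤-<-trans z≤n p<q) same-above cY≡1+cX)
  k<t₀ : k < t₀
  k<t₀ = subst (_≤ t₀) cY≡1+cX
           (≮⇒≥ (λ t₀<cY → <⇒≱ Yₜ₀<q (<count≥⇒≤nth t₀ (sortDesc-descending xs) t₀<cY)))

module _ {R : Rel A ℓ} where

  Linked-++⁻ : ∀ xs {ys} → Linked R (xs ++ ys) → Linked R xs × Linked R ys
  Linked-++⁻ []           l       = [] , l
  Linked-++⁻ (x ∷ [])     l       = [-] , tail l
  Linked-++⁻ (x ∷ y ∷ xs) (r ∷ l) with l₁ , l₂ ← Linked-++⁻ (y ∷ xs) l = r ∷ l₁ , l₂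

  module _ (R-sym : Symmetric R) where

    Linked-ʳ++⁺ : ∀ {x xs ys} → Linked R (x ∷ xs) → Linked R (x ∷ ys) → Linked R ((x ∷ xs) ʳ++ ys)
    Linked-ʳ++⁺ [-]     l′ = l′
    Linked-ʳ++⁺ (r ∷ l) l′ = Linked-ʳ++⁺ l (R-sym r ∷ l′)

    Linked-reverse⁺ : ∀ {xs} → Linked R xs → Linked R (reverse xs)
    Linked-reverse⁺ {[]}    _ = []
    Linked-reverse⁺ {_ ∷ _} l = Linked-ʳ++⁺ l [-]

≢[]⇒length>0 : ∀ {xs : List A} → xs ≢ [] → 0 < length xs
≢[]⇒length>0 {xs = []}    []≢[] = contradiction refl []≢[]
≢[]⇒length>0 {xs = _ ∷ _} _     = z<s

<length⇒≢[] : ∀ {m} {xs : List A} → m < length xs → xs ≢ []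
<length⇒≢[] () refl

concat-↭ : {xss yss : List (List A)} → xss ↭ yss → concat xss ↭ concat yss
concat-↭ ↭.refl          = ↭-refl
concat-↭ (prep xs σ)     = ++⁺ˡ xs (concat-↭ σ)
concat-↭ (swap xs ys σ)  = ↭-trans (shifts xs ys) (++⁺ˡ ys (++⁺ˡ xs (concat-↭ σ)))
concat-↭ (↭.trans σ τ)   = ↭-trans (concat-↭ σ) (concat-↭ τ)

∈-∈-∃↭ : ∀ {xs : List A} {x y} → x ∈ xs → y ∈ xs → x ≢ y → ∃ λ zs → xs ↭ x ∷ y ∷ zs
∈-∈-∃↭ {x = x} {y} x∈ y∈ x≢y with as , bs , refl ← ∈-∃++ x∈
  with ∈-resp-↭ (shift x as bs) y∈
... | here y≡x   = contradiction (sym y≡x) x≢y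
... | there y∈′ with cs , ds , eq ← ∈-∃++ y∈′ =
  cs ++ ds , ↭-trans (shift x as bs) (prep x (↭-trans (↭-reflexive eq) (shift y cs ds)))

module _ {R : Rel A ℓ} (R-sym : Symmetric R) where

  -- Q is cut at a vertex into a longer part D, kept, and a shorter part that is
  -- attached to the path X to form N.
  Rerouting : List A → List A → Set _
  Rerouting X Q = ∃₂ λ N D → Linked R N × Linked R D × N ++ D ↭ X ++ Q
                            × length D < length Q × length Q ≤ length D + suc (length D)

  Rerouting-↭ : ∀ {X Q Q′} → Q′ ↭ Q → Rerouting X Q′ → Rerouting X Q
  Rerouting-↭ {X} {Q} {Q′} σ (N , D , N-linked , D-linked , ρ , D<Q′ , Q′≤) =
    N , D , N-linked , D-linked , ↭-trans ρ (++⁺ˡ X σ) ,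
    subst (length D <_) |Q′|≡|Q| D<Q′ , subst (_≤ _) |Q′|≡|Q| Q′≤
    where
    |Q′|≡|Q| : length Q′ ≡ length Q
    |Q′|≡|Q| = ↭-length σ

  reroute-≤ : ∀ {x X y} C B → Linked R (x ∷ X) → R x y → Linked R (C ++ y ∷ B) →
              length B ≤ length C → Rerouting (x ∷ X) (C ++ y ∷ B)
  reroute-≤ {x} {X} {y} C B X-linked x~y Q-linked B≤C
    with C-linked , yB-linked ← Linked-++⁻ C Q-linked =
    (y ∷ B) ʳ++ x ∷ X , C , Linked-ʳ++⁺ R-sym yB-linked (R-sym x~y ∷ X-linked) , C-linked ,
    perm , subst (length C <_) (sym |Q|) (m<m+n (length C) z<s) ,
    subst (_≤ _) (sym |Q|) (+-monoʳ-≤ (length C) (s≤s B≤C))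
    where
    |Q| : length (C ++ y ∷ B) ≡ length C + suc (length B)
    |Q| = length-++ C
    perm : ((y ∷ B) ʳ++ x ∷ X) ++ C ↭ (x ∷ X) ++ C ++ y ∷ B
    perm = begin
      ((y ∷ B) ʳ++ x ∷ X) ++ C   ↭⟨ ++⁺ʳ C (↭-sym (++↭ʳ++ (y ∷ B) (x ∷ X))) ⟩
      ((y ∷ B) ++ x ∷ X) ++ C    ≡⟨ ++-assoc (y ∷ B) (x ∷ X) C ⟩
      (y ∷ B) ++ (x ∷ X) ++ C    ↭⟨ ++-comm (y ∷ B) ((x ∷ X) ++ C) ⟩
      ((x ∷ X) ++ C) ++ y ∷ B    ≡⟨ ++-assoc (x ∷ X) C (y ∷ B) ⟩
      (x ∷ X) ++ C ++ y ∷ B      ∎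
      where open PermutationReasoning

  reroute : ∀ {x X y Q} → Linked R (x ∷ X) → R x y → Linked R Q → y ∈ Q → Rerouting (x ∷ X) Q
  reroute {x} {X} {y} X-linked x~y Q-linked y∈Q with C , B , refl ← ∈-∃++ y∈Q with length B ≤? length C
  ... | yes B≤C = reroute-≤ C B X-linked x~y Q-linked B≤C
  ... | no  B≰C = Rerouting-↭ (↭-reverse (C ++ y ∷ B))
    (subst (Rerouting (x ∷ X)) (sym reverse-Q)
      (reroute-≤ (reverse B) (reverse C) X-linked x~y
        (subst (Linked R) reverse-Q (Linked-reverse⁺ R-sym Q-linked))
        (subst₂ _≤_ (sym (length-reverse C)) (sym (length-reverse B)) (<⇒≤ (≰⇒> B≰C)))))
    where
    reverse-Q : reverse (C ++ y ∷ B) ≡ reverse B ++ y ∷ reverse C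
    reverse-Q = begin
      reverse (C ++ y ∷ B)              ≡⟨ reverse-++ C (y ∷ B) ⟩
      reverse (y ∷ B) ++ reverse C      ≡⟨ cong (_++ reverse C) (unfold-reverse y B) ⟩
      (reverse B ++ [ y ]) ++ reverse C ≡⟨ ++-assoc (reverse B) [ y ] (reverse C) ⟩
      reverse B ++ y ∷ reverse C        ∎
      where open ≡-Reasoning

module _ {n} (G : Graph n) where

  IsEndpoint⇒oriented : ∀ {x P} → IsEndpoint x P → Linked (Adj G) P →
                        ∃ λ X → Linked (Adj G) (x ∷ X) × x ∷ X ↭ P
  IsEndpoint⇒oriented     (inj₁ (X , refl)) P-linked = X , P-linked , ↭-refl
  IsEndpoint⇒oriented {x} (inj₂ (X , refl)) P-linked =
    reverse X ,
    subst (Linked (Adj G)) (reverse-++ X [ x ]) (Linked-reverse⁺ (Graph.sym G) P-linked) ,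
    ↭-trans (↭-reflexive (sym (reverse-++ X [ x ]))) (↭-reverse (X ++ [ x ]))

  SpanningLinearForest-exchange : ∀ {F P Q rest N D} → SpanningLinearForest G F →
    F ↭ P ∷ Q ∷ rest → IsPath G N → IsPath G D → N ++ D ↭ P ++ Q →
    SpanningLinearForest G (N ∷ D ∷ rest)
  SpanningLinearForest-exchange {F} {P} {Q} {rest} {N} {D} (paths , unique , covers) σ N-path D-path ρ =
    N-path ∷ D-path ∷ rest-paths ,
    SetoidPermutation.Unique-resp-↭ (setoid _) (↭⇒↭ₛ (↭-sym τ)) unique ,
    λ v → ∈-resp-↭ (↭-sym τ) (covers v)
    where
    rest-paths : All (IsPath G) rest
    rest-paths with _ ∷ _ ∷ ps ← All-resp-↭ σ paths = ps
    τ : concat (N ∷ D ∷ rest) ↭ concat F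
    τ = begin
      N ++ D ++ concat rest     ≡⟨ sym (++-assoc N D (concat rest)) ⟩
      (N ++ D) ++ concat rest   ↭⟨ ++⁺ʳ (concat rest) ρ ⟩
      (P ++ Q) ++ concat rest   ≡⟨ ++-assoc P Q (concat rest) ⟩
      concat (P ∷ Q ∷ rest)     ↭⟨ concat-↭ (↭-sym σ) ⟩
      concat F                  ∎
      where open PermutationReasoning

  neighbour-path-not-long : ∀ {F F′ P Q x y} t₀ → LexMinimal G F → length F ≡ length F′ →
    SpanningLinearForest G F′ → (∀ j → j < t₀ → nth (lengths F) j ≡ nth (lengths F′) j) →
    P ∈ F′ → IsEndpoint x P → Q ∈ F′ → y ∈ Q → Adj G x y →
    ¬ (nth (lengths F′) t₀ < length Q × length P + suc (length P) < length Q)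
  neighbour-path-not-long {F} {F′} {P} {Q} t₀ (_ , minimal) |F|≡|F′| F′-span agree
    P∈F′ x-end Q∈F′ y∈Q x~y (sₜ₀<|Q| , long)
    with P<Q ← ≤-<-trans (m≤m+n (length P) _) long
    with rest , σ ← ∈-∈-∃↭ P∈F′ Q∈F′ (λ P≡Q → <-irrefl (cong length P≡Q) P<Q)
    with X , X-linked , X↭P ← IsEndpoint⇒oriented x-end (proj₂ (All.lookup (proj₁ F′-span) P∈F′))
    with N , D , N-linked , D-linked , ρ , D<Q , Q≤2D+1
           ← reroute (Graph.sym G) X-linked x~y (proj₂ (All.lookup (proj₁ F′-span) Q∈F′)) y∈Q =
    minimal (N ∷ D ∷ rest)
      (SpanningLinearForest-exchange F′-span σ (<length⇒≢[] P<N , N-linked) (<length⇒≢[] P<D , D-linked) ρ′)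
      (inj₂ (sym (trans |F|≡|F′| (↭-length σ)) ,
             LexLt-exchange (lengths F) t₀ (↭-map⁺ length σ) P<Q N<Q D<Q sₜ₀<|Q| agree))
    where
    ρ′ : N ++ D ↭ P ++ Q
    ρ′ = ↭-trans ρ (++⁺ʳ Q X↭P)
    |N|+|D| : length N + length D ≡ length P + length Q
    |N|+|D| = trans (sym (length-++ N)) (trans (↭-length ρ′) (length-++ P))
    P<D : length P < length D
    P<D = ≰⇒> λ D≤P → <⇒≱ (<-≤-trans long Q≤2D+1) (+-mono-≤ D≤P (s≤s D≤P))
    N<Q : length N < length Q
    N<Q = <-from-sum |N|+|D| P<D
    P<N : length P < length N
    P<N = <-from-sum (trans (sym |N|+|D|) (+-comm (length N) (length D))) D<Q

lemma4p5 : ∀ {n} (G : Graph n) (t t' : ℕ) → 0 < t' → t' ≤ t →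
    (F F' : List (List (Fin n))) →
    LexMinimal G F → length F ≡ t →
    SpanningLinearForest G F' → length F' ≡ t →
    (∀ j → suc j < t' → nth (lengths F) j ≡ nth (lengths F') j) →
    (x : Fin n) (P : List (Fin n)) → P ∈ F' →
    length P ≤ nth (lengths F') (t' ∸ 1) → IsEndpoint x P →
    ∀ y → Adj G x y → S F' 0 (5 * nth (lengths F') (t' ∸ 1)) y
lemma4p5 G t (suc t₀) _ _ F F' minimal |F|≡t F'-span |F'|≡t agree x P P∈F' P≤s x-end y x~y
  with Q , y∈Q , Q∈F' ← ∈-concat⁻′ F' (proj₂ (proj₂ F'-span) y) =
  Q , Q∈F' , y∈Q , z≤n , ≮⇒≥ Q-not-long
  where
  s : ℕ
  s = nth (lengths F') t₀
  0<s : 0 < s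
  0<s = <-≤-trans (≢[]⇒length>0 (proj₁ (All.lookup (proj₁ F'-span) P∈F'))) P≤s
  Q-not-long : ¬ 5 * s < length Q
  Q-not-long 5s<Q = neighbour-path-not-long G t₀ minimal (trans |F|≡t (sym |F'|≡t)) F'-span
    (λ j → agree j ∘ s<s) P∈F' x-end Q∈F' y∈Q x~y
    ( ≤-<-trans (m≤n*m s 5) 5s<Q
    , ≤-<-trans (≤-trans (+-mono-≤ P≤s (s≤s P≤s)) (n+suc[n]≤5*n 0<s)) 5s<Q)
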